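{- Let $K$ be a countable large field, with fixed sequences $(a_i)$, $(n_i)$ as in the context. Let $\{A^j_i\}_{i,j\in\mathbb N}$ be subsets of $K$ such that for each fixed $j$ the sequence $\{A^j_i\}_{i\in\mathbb N}$ is suitable, and for each fixed $i$ we have $A^0_i\subseteq A^1_i\subseteq A^2_i\subseteq\cdots$. Let $A^\omega_i=\bigcup_{j=0}^\infty A^j_i$. Then $\{A^\omega_i\}_{i\in\mathbb N}$ is suitable.
   Context: A field $K$ is large if every smooth curve $C$ over $K$ with $C(K)\neq\varnothing$ has $C(K)$ infinite. Fix an enumeration $(a_i)_{i\in\mathbb N}$ of the elements of $K$ in which every element appears infinitely often, and a sequence $(n_i)_{i\in\mathbb N}$ listing every integer $\ge 2$ infinitely often. For an integral domain $R$ that is a $K$-algebra and subsets $A,B\subseteq R$, let $C_i(A,B)$ be the conjunction of: (i) $0\in A$; (ii) $B\subseteq A$; (iii) $B-B\subseteq A$; (iv) $B\cdot B\subseteq A$; (v) $a_i\cdot B\subseteq A$; (vi) $-1\notin B$ and $(1+B)^{ -1}\subseteq 1+A$; (vii) whenever $c_0,\ldots,c_{n_i-2}\in B$, the polynomial $X^{n_i}+X^{n_i-1}+c_{n_i-2}X^{n_i-2}+\cdots+c_1X+c_0$ has at least one simple root in $-1+A$. Here $X-Y=\{x-y\}$, $X\cdot Y=\{xy\}$, $X+Y=\{x+y\}$ for $x\in X,y\in Y$. A sequence $\{A_i\}_{i\in\mathbb N}$ of subsets of $R$ is suitable if $C_i(A_i,A_{i+1})$ holds for every $i$. -}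

module Defs where

open import Level using (Level; _⊔_; suc)
open import Algebra.Bundles using (CommutativeRing)
open import Data.Nat as ℕ using (ℕ; _≤_; _∸_)
open import Data.Fin using (Fin)
open import Data.List using (List; []; _∷_; _++_)
open import Data.Vec.Functional using (toList)
open import Data.Product using (Σ; _×_; ∃; ∃-syntax)
open import Relation.Nullary using (¬_)
open import Relation.Unary using (Pred; _⊆_)

record Field (c ℓ : Level) : Set (suc (c ⊔ ℓ)) where
  field
    commutativeRing : CommutativeRing c ℓ
  open CommutativeRing commutativeRing public
  field
    0≉1     : ¬ (0# ≈ 1#)
    inverse : ∀ x → ¬ (x ≈ 0#) → ∃[ y ] (x * y ≈ 1#)

module _ {c ℓ : Level} (F : Field c ℓ) where
  open Field F

  _·ₙ_ : ℕ → Carrier → Carrier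
  ℕ.zero  ·ₙ x = 0#
  ℕ.suc n ·ₙ x = x + (n ·ₙ x)

  -- polynomials as coefficient lists, lowest degree first
  eval : List Carrier → Carrier → Carrier
  eval []       x = 0#
  eval (c ∷ cs) x = c + x * eval cs x

  private
    derivAux : ℕ → List Carrier → List Carrier
    derivAux k []       = []
    derivAux k (d ∷ ds) = (k ·ₙ d) ∷ derivAux (ℕ.suc k) ds

  deriv : List Carrier → List Carrier
  deriv []       = []
  deriv (c ∷ cs) = derivAux 1 cs

  SimpleRoot : List Carrier → Carrier → Set ℓ
  SimpleRoot p r = (eval p r ≈ 0#) × ¬ (eval (deriv p) r ≈ 0#)

  -- coefficient list of X^(m+2) + X^(m+1) + c_m X^m + ... + c_1 X + c_0
  -- (so n = m + 2 and c : Fin (n - 1) gives c_0, ..., c_{n-2})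
  polyC : (m : ℕ) → (Fin (ℕ.suc m) → Carrier) → List Carrier
  polyC m cf = toList cf ++ (1# ∷ 1# ∷ [])

  -- the condition C_i(A, B), with a_i = ai and n_i = ni (n_i = m + 2, m = n_i ∸ 2)
  Cond : ∀ {p} → Carrier → ℕ → Pred Carrier p → Pred Carrier p → Set (c ⊔ ℓ ⊔ p)
  Cond ai ni A B =
      A 0#
    × B ⊆ A
    × (∀ x y → B x → B y → A (x - y))
    × (∀ x y → B x → B y → A (x * y))
    × (∀ x → B x → A (ai * x))
    × (∀ b → B b → ¬ (b ≈ - 1#))
    × (∀ b → B b → ∃[ a ] (A a × ((1# + b) * (1# + a) ≈ 1#)))
    × (∀ (cf : Fin (ℕ.suc (ni ∸ 2)) → Carrier) → (∀ k → B (cf k)) →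
         ∃[ r ] (SimpleRoot (polyC (ni ∸ 2) cf) r × ∃[ a ] (A a × (r ≈ - 1# + a))))

  Suitable : ∀ {p} → (ℕ → Carrier) → (ℕ → ℕ) → (ℕ → Pred Carrier p) → Set (c ⊔ ℓ ⊔ p)
  Suitable a n A = ∀ i → Cond (a i) (n i) (A i) (A (ℕ.suc i))

{-# OPTIONS --safe #-}
module Submission where

-- Every clause of C_i(A, B) only involves finitely many elements of B at a time
-- (none, one, two, or the n_i - 1 coefficients of the polynomial), and asks for
-- at most one element of A.  Along an increasing chain of B's those finitely
-- many elements already lie in one stage B^J, where C_i(A^J, B^J) supplies what
-- is needed, inside A^J ⊆ A^ω.  Only the B-side chain has to be increasing.

open import Defs
open import Level using (Level)
open import Data.Nat using (ℕ; zero; suc; _≤_; _∸_; _⊔_; _≤′_; ≤′-reflexive; ≤′-step)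
open import Data.Nat.Properties using (≤⇒≤′; m≤m⊔n; m≤n⊔m)
open import Data.Fin using (Fin)
import Data.Fin as Fin
open import Data.Product using (Σ; _×_; _,_; ∃-syntax)
open import Function using (_∘_)
open import Relation.Unary using (Pred; _⊆_; _∈_; ⋃)
open import Relation.Nullary using (¬_)
open import Relation.Binary.PropositionalEquality using (_≡_; refl)

module _ {a p : Level} {X : Set a} {B : ℕ → Pred X p}
         (B-increasing : ∀ j → B j ⊆ B (suc j)) where

  increasing⇒monotone : ∀ {j k} → j ≤ k → B j ⊆ B k
  increasing⇒monotone = go ∘ ≤⇒≤′
    where
    go : ∀ {j k} → j ≤′ k → B j ⊆ B k
    go (≤′-reflexive refl) x∈ = x∈
    go (≤′-step j≤k)       x∈ = B-increasing _ (go j≤k x∈)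

  pair-in-common-stage : ∀ {x y} → x ∈ ⋃ ℕ B → y ∈ ⋃ ℕ B → ∃[ J ] (x ∈ B J × y ∈ B J)
  pair-in-common-stage (j , x∈) (k , y∈) =
    j ⊔ k , increasing⇒monotone (m≤m⊔n j k) x∈ , increasing⇒monotone (m≤n⊔m j k) y∈

  family-in-common-stage : ∀ {k} (xs : Fin k → X) → (∀ t → xs t ∈ ⋃ ℕ B) →
                           ∃[ J ] (∀ t → xs t ∈ B J)
  family-in-common-stage {zero}  xs xs∈ = 0 , λ ()
  family-in-common-stage {suc k} xs xs∈
    with xs∈ Fin.zero | family-in-common-stage (xs ∘ Fin.suc) (xs∈ ∘ Fin.suc)
  ... | j , head∈ | J , tail∈ = j ⊔ J , λ
    { Fin.zero    → increasing⇒monotone (m≤m⊔n j J) head∈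
    ; (Fin.suc t) → increasing⇒monotone (m≤n⊔m j J) (tail∈ t)
    }

module _ {c ℓ : Level} (F : Field c ℓ) where
  open Field F

  Cond-⋃ : ∀ {p ai ni} {A B : ℕ → Pred Carrier p} → (∀ j → B j ⊆ B (suc j)) →
           (∀ j → Cond F ai ni (A j) (B j)) → Cond F ai ni (⋃ ℕ A) (⋃ ℕ B)
  Cond-⋃ {ai = ai} {ni} {A} {B} B-increasing C =
    zero∈ , B⊆A , diff∈ , prod∈ , scaled∈ , ≉-1 , inverse∈ , root∈
    where
    zero∈ : 0# ∈ ⋃ ℕ A
    zero∈ with C 0
    ... | 0∈ , _ = 0 , 0∈

    B⊆A : ⋃ ℕ B ⊆ ⋃ ℕ A
    B⊆A (j , b∈) with C j
    ... | _ , Bʲ⊆Aʲ , _ = j , Bʲ⊆Aʲ b∈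

    diff∈ : ∀ x y → x ∈ ⋃ ℕ B → y ∈ ⋃ ℕ B → x - y ∈ ⋃ ℕ A
    diff∈ x y x∈ y∈ with pair-in-common-stage B-increasing x∈ y∈
    ... | J , x∈ᴶ , y∈ᴶ with C J
    ...   | _ , _ , closed , _ = J , closed x y x∈ᴶ y∈ᴶ

    prod∈ : ∀ x y → x ∈ ⋃ ℕ B → y ∈ ⋃ ℕ B → x * y ∈ ⋃ ℕ A
    prod∈ x y x∈ y∈ with pair-in-common-stage B-increasing x∈ y∈
    ... | J , x∈ᴶ , y∈ᴶ with C J
    ...   | _ , _ , _ , closed , _ = J , closed x y x∈ᴶ y∈ᴶ

    scaled∈ : ∀ x → x ∈ ⋃ ℕ B → ai * x ∈ ⋃ ℕ A
    scaled∈ x (j , x∈) with C j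
    ... | _ , _ , _ , _ , closed , _ = j , closed x x∈

    ≉-1 : ∀ b → b ∈ ⋃ ℕ B → ¬ (b ≈ - 1#)
    ≉-1 b (j , b∈) with C j
    ... | _ , _ , _ , _ , _ , b≉-1 , _ = b≉-1 b b∈

    inverse∈ : ∀ b → b ∈ ⋃ ℕ B → ∃[ a ] (a ∈ ⋃ ℕ A × (1# + b) * (1# + a) ≈ 1#)
    inverse∈ b (j , b∈) with C j
    ... | _ , _ , _ , _ , _ , _ , inv , _ with inv b b∈
    ...   | a , a∈ , eq = a , (j , a∈) , eq

    root∈ : ∀ (cf : Fin (suc (ni ∸ 2)) → Carrier) → (∀ k → cf k ∈ ⋃ ℕ B) →
            ∃[ r ] (SimpleRoot F (polyC F (ni ∸ 2) cf) r × ∃[ a ] (a ∈ ⋃ ℕ A × r ≈ - 1# + a))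
    root∈ cf cf∈ with family-in-common-stage B-increasing cf cf∈
    ... | J , cf∈ᴶ with C J
    ...   | _ , _ , _ , _ , _ , _ , _ , roots with roots cf cf∈ᴶ
    ...     | r , simple , a , a∈ , eq = r , simple , a , (J , a∈) , eq

lemma2p7 : ∀ {c ℓ p : Level} (F : Field c ℓ) →
    let open Field F in
    -- K countable: a surjection ℕ → K
    (Σ (ℕ → Carrier) λ e → (∀ (x : Carrier) → ∃[ k ] (e k ≈ x))) →
    (a : ℕ → Carrier) → (∀ (x : Carrier) (N : ℕ) → ∃[ i ] ((N ≤ i) × (a i ≈ x))) →
    (n : ℕ → ℕ) → (∀ i → 2 ≤ n i) → (∀ m N → 2 ≤ m → ∃[ i ] ((N ≤ i) × (n i ≡ m))) →
    (A : ℕ → ℕ → Pred Carrier p) →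
    (∀ j → Suitable F a n (λ i → A i j)) →
    (∀ i j → A i j ⊆ A i (suc j)) →
    Suitable F a n (λ i x → Σ ℕ (λ j → A i j x))
lemma2p7 F _ a _ n _ _ A suitable increasing i =
  Cond-⋃ F {ni = n i} (increasing (suc i)) (λ j → suitable j i)
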